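{- Let $a$ and $b$ be positive integers such that $a$ has a prime factor not dividing $b$. Then there are infinitely many positive integers $n$ such that $bn+1$ does not divide $\binom{an+bn}{an}$. Moreover, if $p$ is a prime with $p\mid a$ and $p\nmid b$, then $f(a,b)\le \frac{p^{\varphi(a+b)}-1}{a+b}$, where $\varphi$ is Euler's totient function.
   Context: For positive integers $a,b$, the function $f(a,b)$ is defined as follows: if $\binom{an+bn}{an}$ is divisible by $bn+1$ for all positive integers $n$, then $f(a,b)=0$; otherwise $f(a,b)$ is the smallest positive integer $n$ such that $\binom{an+bn}{an}$ is not divisible by $bn+1$. -}

module Defs where

open import Data.Nat using (ℕ; zero; suc; _+_; _*_; _<_; _≤_)
open import Data.Nat.Divisibility using (_∣_)
open import Data.Nat.GCD using (gcd)
open import Data.Nat.Combinatorics using (_C_)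
open import Data.Nat.Properties using (_≟_)
open import Data.List using (List; length; filter; upTo; map)
open import Data.Product using (_×_)
open import Relation.Nullary using (¬_)
open import Relation.Binary.PropositionalEquality using (_≡_)

φ : ℕ → ℕ
φ m = length (filter (λ k → gcd k m ≟ 1) (map suc (upTo m)))

Divides : ℕ → ℕ → ℕ → Set
Divides a b n = (b * n + 1) ∣ ((a * n + b * n) C (a * n))

-- IsF a b m  :⇔  f(a,b) = m, following the paper's definition:
--   m = 0 and the divisibility holds for all positive n, or
--   m is the least positive n for which it fails.
data IsF (a b : ℕ) : ℕ → Set where
  f-zero : (∀ n → 0 < n → Divides a b n) → IsF a b 0
  f-least : ∀ m → 0 < m → ¬ Divides a b m
          → (∀ n → 0 < n → n < m → Divides a b n) → IsF a b m

module Submission where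

-- Proof of Theorem 2.1.  Put m = a + b and fix a prime p with p ∣ a, p ∤ b.
--
-- * Binomial coefficients below a prime power: if M + 1 = pᵉ then p divides
--   no C(M, j), 0 ≤ j ≤ M.  The absorption identity
--   (j+1)·C(M+1, j+1) = (M+1)·C(M, j) gives p ∣ C(M+1, j+1) for j < M, and
--   Pascal's rule then carries p ∤ C(M, j) from j to j + 1, starting at C(M,0) = 1.
-- * Counterexamples from powers of p: if pᵉ = 1 + n·m with e > 0, then
--   p ∣ pᵉ − an = bn + 1 while p ∤ C(an + bn, an), so bn + 1 ∤ C(an + bn, an).
-- * Order of p modulo m: since p ∤ m, two of the φ(m) + 1 unit residues
--   p⁰, …, p^φ(m) (mod m) coincide, so pᵏ ≡ 1 (mod m) for some 0 < k ≤ φ(m).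
-- * The powers p^(k·t) are again ≡ 1 (mod m) and arbitrarily large, giving
--   infinitely many counterexamples; a bounded search below the counterexample
--   (pᵏ − 1)/m finds the least one, f(a,b), and bounds it by (p^φ(m) − 1)/m.

open import Defs
open import Data.Nat.Base
open import Data.Nat.Properties
open import Data.Nat.DivMod using (_%_; _/_; m≡m%n+[m/n]*n; m%n<n; m/n*n≡m)
open import Data.Nat.Divisibility
open import Data.Nat.Primality using (Prime; prime⇒nonTrivial; prime⇒nonZero; prime⇒irreducible)
open import Data.Nat.Combinatorics using (_C_; nCk≡n!/k![n-k]!; k![n∸k]!∣n!; nCk+nC[k+1]≡[n+1]C[k+1])
open import Data.Nat.GCD using (gcd; gcd-greatest)
open import Data.Nat.Coprimality as Coprimality using (Coprime; coprime-divisor; coprime⇒gcd≡1)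
open import Data.Nat.Solver using (module +-*-Solver)
open import Data.List using (List; filter; map; upTo; lookup)
open import Data.List.Membership.Propositional using (_∈_)
open import Data.List.Membership.Propositional.Properties using (∈-filter⁺; ∈-map⁺; ∈-upTo⁺)
open import Data.List.Relation.Unary.Any using (index)
open import Data.List.Relation.Unary.Any.Properties using (lookup-index)
open import Data.Fin.Base using (Fin; toℕ)
open import Data.Fin.Properties using (pigeonhole; toℕ<n)
open import Data.Product using (Σ; ∃; ∃₂; _×_; _,_; proj₁; proj₂)
open import Data.Sum using (_⊎_; inj₁; inj₂)
open import Data.Empty using (⊥-elim)
open import Relation.Nullary using (¬_; yes; no; Dec)
open import Relation.Nullary.Decidable using (decidable-stable)
open import Relation.Binary.PropositionalEquality
open +-*-Solver

prime>1 : ∀ {p} → Prime p → 1 < p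
prime>1 {p} p-prime = nonTrivial⇒n>1 p {{prime⇒nonTrivial p-prime}}

prime^pos>1 : ∀ {p k} → Prime p → 0 < k → 1 < p ^ k
prime^pos>1 {p} p-prime 0<k = ^-monoʳ-< p (prime>1 p-prime) 0<k

*-pos : ∀ {x y} → 0 < x → 0 < y → 0 < x * y
*-pos {suc x} {suc y} _ _ = z<s

n<m^n : ∀ X t → 1 < X → t < X ^ t
n<m^n X zero    _   = z<s
n<m^n X (suc t) 1<X = begin-strict
    suc t          ≤⟨ ih ⟩
    X ^ t          <⟨ m<m+n (X ^ t) (<-≤-trans z<s ih) ⟩
    X ^ t + X ^ t  ≡⟨ cong (X ^ t +_) (sym (+-identityʳ (X ^ t))) ⟩
    2 * X ^ t      ≤⟨ *-monoˡ-≤ (X ^ t) 1<X ⟩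
    X * X ^ t      ∎
  where
  open ≤-Reasoning
  ih = n<m^n X t 1<X

prime∤⇒coprime : ∀ {p m} → Prime p → ¬ p ∣ m → Coprime m p
prime∤⇒coprime p-prime p∤m {d} (d∣m , d∣p) with prime⇒irreducible p-prime d∣p
... | inj₁ d≡1 = d≡1
... | inj₂ refl = ⊥-elim (p∤m d∣m)

coprime-* : ∀ {m x y} → Coprime m x → Coprime m y → Coprime m (x * y)
coprime-* {m} {x} cx cy {d} (d∣m , d∣xy) = cy (d∣m , coprime-divisor d⊥x d∣xy)
  where
  d⊥x : Coprime d x
  d⊥x (e∣d , e∣x) = cx (∣-trans e∣d d∣m , e∣x)

coprime-^ : ∀ {m x} → Coprime m x → ∀ i → Coprime m (x ^ i)
coprime-^ c zero    (_ , d∣1) = ∣1⇒≡1 d∣1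
coprime-^ c (suc i) = coprime-* c (coprime-^ c i)

-- If pᵉ ∣ j·x with 0 < j < pᵉ then p ∣ x: otherwise pᵉ would be coprime
-- to x and hence divide j.
prime^∣*⇒prime∣ : ∀ {p e j x} → Prime p → 0 < j → j < p ^ e → p ^ e ∣ j * x → p ∣ x
prime^∣*⇒prime∣ {p} {e} {j} {x} p-prime 0<j j<pᵉ pᵉ∣jx =
  decidable-stable (p ∣? x) λ p∤x →
    <⇒≱ j<pᵉ (∣⇒≤ {{>-nonZero 0<j}}
      (coprime-divisor (Coprimality.sym (coprime-^ (prime∤⇒coprime p-prime p∤x) e))
                       (subst (p ^ e ∣_) (*-comm j x) pᵉ∣jx)))

nCk*k![n∸k]!≡n! : ∀ n k → k ≤ n → (n C k) * (k ! * (n ∸ k) !) ≡ n !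
nCk*k![n∸k]!≡n! n k k≤n = trans (cong (_* (k ! * (n ∸ k) !)) (nCk≡n!/k![n-k]! k≤n))
                                (m/n*n≡m (k![n∸k]!∣n! k≤n))
  where instance _ = k !* (n ∸ k) !≢0

absorption : ∀ M i → i ≤ M → suc i * (suc M C suc i) ≡ suc M * (M C i)
absorption M i i≤M = *-cancelʳ-≡ _ _ (i ! * R) eq
  where
  instance _ = i !* (M ∸ i) !≢0
  R = (M ∸ i) !
  X = suc M C suc i
  Y = M C i
  eq : suc i * X * (i ! * R) ≡ suc M * Y * (i ! * R)
  eq = begin
    suc i * X * (i ! * R)    ≡⟨ solve 4 (λ s x f r → s :* x :* (f :* r) := x :* (s :* f :* r)) refl (suc i) X (i !) R ⟩
    X * (suc i ! * R)        ≡⟨ nCk*k![n∸k]!≡n! (suc M) (suc i) (s≤s i≤M) ⟩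
    suc M !                  ≡⟨ cong (suc M *_) (sym (nCk*k![n∸k]!≡n! M i i≤M)) ⟩
    suc M * (Y * (i ! * R))  ≡⟨ sym (*-assoc (suc M) Y _) ⟩
    suc M * Y * (i ! * R)    ∎
    where open ≡-Reasoning

module _ {p e M : ℕ} (p-prime : Prime p) (M+1≡pᵉ : suc M ≡ p ^ e) where

  prime∣interiorBinomial : ∀ j → j < M → p ∣ suc M C suc j
  prime∣interiorBinomial j j<M = prime^∣*⇒prime∣ {e = e} p-prime z<s
    (subst (suc j <_) M+1≡pᵉ (s≤s j<M))
    (subst (_∣ suc j * (suc M C suc j)) M+1≡pᵉ
      (subst (suc M ∣_) (sym (absorption M j (<⇒≤ j<M))) (m∣m*n (M C j))))

  prime∤binomial : ∀ j → j ≤ M → ¬ p ∣ M C j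
  prime∤binomial zero    _      p∣1 = <⇒≢ (prime>1 p-prime) (sym (∣1⇒≡1 p∣1))
  prime∤binomial (suc j) j+1≤M p∣C =
    prime∤binomial j (<⇒≤ j+1≤M) (∣m+n∣m⇒∣n p∣sum p∣C)
    where
    p∣sum : p ∣ M C suc j + M C j
    p∣sum = subst (p ∣_) (trans (sym (nCk+nC[k+1]≡[n+1]C[k+1] M j)) (+-comm (M C j) _))
                  (prime∣interiorBinomial j j+1≤M)

-- If p ∣ a and pᵉ = 1 + n·(a+b) with e > 0, then bn+1 ∤ C(an+bn, an):
-- p divides bn+1 = pᵉ − an (as e > 0) but not C(pᵉ − 1, an).
prime^≡1+n*m⇒¬Divides : ∀ {p a b e n} → Prime p → p ∣ a → 0 < e
                      → p ^ e ≡ suc (n * (a + b)) → ¬ Divides a b n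
prime^≡1+n*m⇒¬Divides {p} {a} {b} {suc e} {n} p-prime p∣a _ pᵉ≡ bn+1∣C =
  prime∤binomial {e = suc e} p-prime M+1≡pᵉ (a * n) (m≤m+n (a * n) (b * n)) (∣-trans p∣bn+1 bn+1∣C)
  where
  M+1≡pᵉ : suc (a * n + b * n) ≡ p ^ suc e
  M+1≡pᵉ = trans (cong suc (solve 3 (λ a b n → a :* n :+ b :* n := n :* (a :+ b)) refl a b n))
                 (sym pᵉ≡)
  pᵉ≡an+[bn+1] : p ^ suc e ≡ a * n + (b * n + 1)
  pᵉ≡an+[bn+1] = trans (sym M+1≡pᵉ)
    (solve 3 (λ a b n → con 1 :+ (a :* n :+ b :* n) := a :* n :+ (b :* n :+ con 1)) refl a b n)
  p∣bn+1 : p ∣ b * n + 1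
  p∣bn+1 = ∣m+n∣m⇒∣n (subst (p ∣_) pᵉ≡an+[bn+1] (m∣m*n (p ^ e))) (∣-trans p∣a (m∣m*n n))

units : ℕ → List ℕ
units m = filter (λ k → gcd k m ≟ 1) (map suc (upTo m))

∈-units : ∀ {m x} → 1 < m → x < m → gcd x m ≡ 1 → x ∈ units m
∈-units {m} {zero} 1<m _ gcd≡1 =
  ⊥-elim (<⇒≢ 1<m (sym (∣1⇒≡1 (subst (m ∣_) gcd≡1 (gcd-greatest (m ∣0) ∣-refl)))))
∈-units {m} {suc r} 1<m r<m gcd≡1 =
  ∈-filter⁺ (λ k → gcd k m ≟ 1) (∈-map⁺ suc (∈-upTo⁺ (<-trans (n<1+n r) r<m))) gcd≡1

coprime-% : ∀ {m x} .{{_ : NonZero m}} → Coprime m x → Coprime (x % m) m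
coprime-% m⊥x (d∣r , d∣m) = m⊥x (d∣m , ∣n∣m%n⇒∣m d∣m d∣r)

%≡%⇒∣∸ : ∀ m x y .{{_ : NonZero m}} → x % m ≡ y % m → m ∣ y ∸ x
%≡%⇒∣∸ m x y eq = divides (y / m ∸ x / m) (begin
    y ∸ x                                    ≡⟨ cong₂ _∸_ (m≡m%n+[m/n]*n y m) (m≡m%n+[m/n]*n x m) ⟩
    (y % m + y / m * m) ∸ (x % m + x / m * m) ≡⟨ cong (λ r → (r + y / m * m) ∸ (x % m + x / m * m)) (sym eq) ⟩
    (x % m + y / m * m) ∸ (x % m + x / m * m) ≡⟨ [m+n]∸[m+o]≡n∸o (x % m) _ _ ⟩
    y / m * m ∸ x / m * m                    ≡⟨ sym (*-distribʳ-∸ m (y / m) (x / m)) ⟩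
    (y / m ∸ x / m) * m                      ∎)
  where open ≡-Reasoning

∣∸1⇒≡1-mod : ∀ {m X} → 0 < X → m ∣ X ∸ 1 → ∃ λ q → X ≡ suc (q * m)
∣∸1⇒≡1-mod {m} {X} 0<X (divides q X∸1≡qm) =
  q , trans (sym (m∸n+n≡m 0<X)) (trans (+-comm (X ∸ 1) 1) (cong suc X∸1≡qm))

module _ {p m : ℕ} .{{_ : NonZero m}} (p-prime : Prime p) (p∤m : ¬ p ∣ m) where

  private instance _ = prime⇒nonZero p-prime

  m⊥p^ : ∀ i → Coprime m (p ^ i)
  m⊥p^ = coprime-^ (prime∤⇒coprime p-prime p∤m)

  power-residue∈units : 1 < m → ∀ i → p ^ i % m ∈ units m
  power-residue∈units 1<m i =
    ∈-units 1<m (m%n<n (p ^ i) m) (coprime⇒gcd≡1 (coprime-% (m⊥p^ i)))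

  -- Two powers p^I, p^J (I < J) with equal residues give p^(J−I) ≡ 1 (mod m):
  -- m ∣ p^J − p^I = p^I·(p^(J−I) − 1), and m is coprime to p^I.
  equal-residues⇒≡1 : ∀ {I J} → I < J → p ^ I % m ≡ p ^ J % m
                    → ∃ λ q → p ^ (J ∸ I) ≡ suc (q * m)
  equal-residues⇒≡1 {I} {J} I<J same = ∣∸1⇒≡1-mod (m^n>0 p k)
    (coprime-divisor (m⊥p^ I) (subst (m ∣_) p^J∸p^I≡ (%≡%⇒∣∸ m (p ^ I) (p ^ J) same)))
    where
    k = J ∸ I
    open ≡-Reasoning
    p^J∸p^I≡ : p ^ J ∸ p ^ I ≡ p ^ I * (p ^ k ∸ 1)
    p^J∸p^I≡ = begin
      p ^ J ∸ p ^ I                  ≡⟨ cong (λ t → p ^ t ∸ p ^ I) (sym (m+[n∸m]≡n (<⇒≤ I<J))) ⟩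
      p ^ (I + k) ∸ p ^ I            ≡⟨ cong₂ _∸_ (^-distribˡ-+-* p I k) (sym (*-identityʳ (p ^ I))) ⟩
      p ^ I * p ^ k ∸ p ^ I * 1      ≡⟨ sym (*-distribˡ-∸ (p ^ I) (p ^ k) 1) ⟩
      p ^ I * (p ^ k ∸ 1)            ∎

  -- If p ∤ m, m > 1, then pᵏ ≡ 1 (mod m) for some 0 < k ≤ φ(m), by the
  -- pigeonhole principle applied to the residues of p⁰, …, p^φ(m).
  order≤φ : 1 < m → ∃ λ k → ∃ λ q → 0 < k × k ≤ φ m × p ^ k ≡ suc (q * m)
  order≤φ 1<m = collision⇒order (pigeonhole (n<1+n (φ m)) slot)
    where
    residue∈ = power-residue∈units 1<m
    slot : Fin (suc (φ m)) → Fin (φ m)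
    slot i = index (residue∈ (toℕ i))
    collision⇒order : (∃₂ λ i j → toℕ i < toℕ j × slot i ≡ slot j)
                    → ∃ λ k → ∃ λ q → 0 < k × k ≤ φ m × p ^ k ≡ suc (q * m)
    collision⇒order (i , j , i<j , same-slot) =
      toℕ j ∸ toℕ i , q , m<n⇒0<n∸m i<j , ≤-trans (m∸n≤m (toℕ j) (toℕ i)) (≤-pred (toℕ<n j)) , pᵏ≡
      where
      same-residue : p ^ toℕ i % m ≡ p ^ toℕ j % m
      same-residue = trans (lookup-index (residue∈ (toℕ i)))
        (trans (cong (lookup (units m)) same-slot) (sym (lookup-index (residue∈ (toℕ j)))))
      q = proj₁ (equal-residues⇒≡1 i<j same-residue)
      pᵏ≡ = proj₂ (equal-residues⇒≡1 i<j same-residue)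

^-preserves-≡1-mod : ∀ {m X q} → X ≡ suc (q * m) → ∀ t → ∃ λ Q → X ^ t ≡ suc (Q * m)
^-preserves-≡1-mod X≡ zero = 0 , refl
^-preserves-≡1-mod {m} {X} {q} X≡ (suc t) with ^-preserves-≡1-mod {m} {X} {q} X≡ t
... | Q , Xᵗ≡ = Q + q * suc (Q * m) , trans (cong₂ _*_ X≡ Xᵗ≡)
  (solve 3 (λ q Q m → (con 1 :+ q :* m) :* (con 1 :+ Q :* m) := con 1 :+ (Q :+ q :* (con 1 :+ Q :* m)) :* m)
           refl q Q m)

-- Given pᵏ ≡ 1 (mod a+b) with k > 0, the powers p^(k·t) for t = (N+1)(a+b)
-- yield a counterexample n with pᵏᵗ = 1 + n(a+b) > t, hence n > N.
counterexamples-unbounded : ∀ {p a b k q} → Prime p → p ∣ a → 0 < a + b → 0 < k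
  → p ^ k ≡ suc (q * (a + b)) → ∀ N → ∃ λ n → N < n × ¬ Divides a b n
counterexamples-unbounded {p} {a} {b} {k} {q} p-prime p∣a 0<m 0<k pᵏ≡ N =
  n , N<n , prime^≡1+n*m⇒¬Divides {n = n} p-prime p∣a 0<k*t pᵏᵗ≡
  where
  m = a + b
  t = suc N * m
  0<k*t : 0 < k * t
  0<k*t = *-pos {k} {t} 0<k (*-pos {suc N} {m} z<s 0<m)
  instance _ = >-nonZero 0<m
  power : ∃ λ Q → (p ^ k) ^ t ≡ suc (Q * m)
  power = ^-preserves-≡1-mod {m} {p ^ k} {q} pᵏ≡ t
  n = proj₁ power
  pᵏᵗ≡ : p ^ (k * t) ≡ suc (n * m)
  pᵏᵗ≡ = trans (sym (^-*-assoc p k t)) (proj₂ power)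
  N<n : N < n
  N<n = *-cancelʳ-≤ (suc N) n m
          (≤-pred (subst (t <_) (proj₂ power) (n<m^n (p ^ k) t (prime^pos>1 p-prime 0<k))))

record LeastFailure (P : ℕ → Set) (m : ℕ) : Set where
  field
    positive : 0 < m
    fails    : ¬ P m
    below    : ∀ n → 0 < n → n < m → P n

module _ {P : ℕ → Set} (P? : ∀ n → Dec (P n)) where

  search : ∀ K → (∀ n → 0 < n → n ≤ K → P n) ⊎ ∃ λ m → m ≤ K × LeastFailure P m
  search zero = inj₁ λ n 0<n n≤0 → ⊥-elim (<⇒≱ 0<n n≤0)
  search (suc K) with search K
  ... | inj₂ (m , m≤K , least) = inj₂ (m , m≤n⇒m≤1+n m≤K , least)
  ... | inj₁ upToK with P? (suc K)
  ...   | no ¬P = inj₂ (suc K , ≤-refl , record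
          { positive = z<s ; fails = ¬P ; below = λ n 0<n n<K+1 → upToK n 0<n (≤-pred n<K+1) })
  ...   | yes P[K+1] = inj₁ upToK+1
    where
    upToK+1 : ∀ n → 0 < n → n ≤ suc K → P n
    upToK+1 n 0<n n≤K+1 with m≤n⇒m<n∨m≡n n≤K+1
    ... | inj₁ n<K+1 = upToK n 0<n (≤-pred n<K+1)
    ... | inj₂ refl  = P[K+1]

  leastFailure≤ : ∀ n → 0 < n → ¬ P n → ∃ λ m → m ≤ n × LeastFailure P m
  leastFailure≤ n 0<n ¬P with search n
  ... | inj₁ all   = ⊥-elim (¬P (all n 0<n ≤-refl))
  ... | inj₂ least = least

-- Given pᵏ = 1 + q(a+b) with 0 < k ≤ φ(a+b), q is a counterexample, so f(a,b) is
-- the least failure below q and f(a,b)·(a+b) ≤ pᵏ − 1 ≤ p^φ(a+b) − 1.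
f-bound : ∀ {p a b k q} → Prime p → p ∣ a → 0 < k → k ≤ φ (a + b)
  → p ^ k ≡ suc (q * (a + b)) → ∃ λ m → IsF a b m × m * (a + b) ≤ p ^ φ (a + b) ∸ 1
f-bound {p} {a} {b} {k} {q} p-prime p∣a 0<k k≤φ pᵏ≡ =
  n₀ , f-least n₀ positive fails below , n₀*[a+b]≤
  where
  0<q : 0 < q
  0<q = n≢0⇒n>0 λ { refl → <⇒≢ (prime^pos>1 p-prime 0<k) (sym pᵏ≡) }
  Divides? : ∀ n → Dec (Divides a b n)
  Divides? n = (b * n + 1) ∣? ((a * n + b * n) C (a * n))
  least≤q : ∃ λ n → n ≤ q × LeastFailure (Divides a b) n
  least≤q = leastFailure≤ Divides? q 0<q (prime^≡1+n*m⇒¬Divides {n = q} p-prime p∣a 0<k pᵏ≡)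
  n₀ = proj₁ least≤q
  open LeastFailure (proj₂ (proj₂ least≤q))
  instance _ = prime⇒nonZero p-prime
  open ≤-Reasoning
  n₀*[a+b]≤ : n₀ * (a + b) ≤ p ^ φ (a + b) ∸ 1
  n₀*[a+b]≤ = begin
    n₀ * (a + b)           ≤⟨ *-monoˡ-≤ (a + b) (proj₁ (proj₂ least≤q)) ⟩
    q * (a + b)            ≡⟨ cong (_∸ 1) (sym pᵏ≡) ⟩
    p ^ k ∸ 1              ≤⟨ ∸-monoˡ-≤ 1 (^-monoʳ-≤ p k≤φ) ⟩
    p ^ φ (a + b) ∸ 1      ∎

-- Theorem 2.1.  A prime dividing a but not b does not divide a + b > 1, so it
-- has a power ≡ 1 (mod a + b) of exponent at most φ(a + b); the two parts then
-- follow from the last two lemmas.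
theorem2p1 : (a b : ℕ) → 0 < a → 0 < b
    → (Σ ℕ λ q → Prime q × q ∣ a × ¬ (q ∣ b))
    → ((N : ℕ) → ∃ λ n → N < n × ¬ Divides a b n)
    × ((p : ℕ) → Prime p → p ∣ a → ¬ (p ∣ b)
    → ∃ λ m → IsF a b m × m * (a + b) ≤ p ^ φ (a + b) ∸ 1)
theorem2p1 a b 0<a 0<b (r , r-prime , r∣a , r∤b) = unbounded , bound
  where
  1<a+b : 1 < a + b
  1<a+b = +-mono-≤ 0<a 0<b
  instance _ = >-nonZero (<-trans z<s 1<a+b)
  ∤a+b : ∀ {p} → p ∣ a → ¬ p ∣ b → ¬ p ∣ a + b
  ∤a+b p∣a p∤b p∣a+b = p∤b (∣m+n∣m⇒∣n p∣a+b p∣a)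
  unbounded : (N : ℕ) → ∃ λ n → N < n × ¬ Divides a b n
  unbounded =
    let (k , q , 0<k , _ , rᵏ≡) = order≤φ r-prime (∤a+b r∣a r∤b) 1<a+b
    in  counterexamples-unbounded {k = k} {q = q} r-prime r∣a (<-trans z<s 1<a+b) 0<k rᵏ≡
  bound : (p : ℕ) → Prime p → p ∣ a → ¬ (p ∣ b)
        → ∃ λ m → IsF a b m × m * (a + b) ≤ p ^ φ (a + b) ∸ 1
  bound p p-prime p∣a p∤b =
    let (k , q , 0<k , k≤φ , pᵏ≡) = order≤φ p-prime (∤a+b p∣a p∤b) 1<a+b
    in  f-bound {k = k} {q = q} p-prime p∣a 0<k k≤φ pᵏ≡
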